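{- Let $(B_{n,p})_{n,p\ge 0}$ be the $p$-Bernoulli numbers, i.e. the unique family of numbers such that $B_{n,0}=B_n$ is the classical Bernoulli number for every $n\ge 0$ (so that $\sum_{n\ge0}B_n\frac{t^n}{n!}=\frac{t}{e^t-1}$), and \[ B_{n+1,p}=pB_{n,p}-\frac{(p+1)^2}{p+2}B_{n,p+1}\qquad\text{for all } n,p\ge 0 . \] Then for every integer $p\ge 0$, \[ \sum_{n=0}^{\infty}B_{n,p}\frac{t^n}{n!}=\frac{(p+1)(t-H_p)e^{pt}}{(e^t-1)^{p+1}}+(p+1)\sum_{k=1}^{p}\binom{p}{k}\frac{H_k}{(e^t-1)^{k+1}}, \] where $H_n=\sum_{j=1}^{n}\frac1j$ denotes the $n$-th harmonic number (with $H_0=0$).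
   Context: The recursion determines $B_{n,p+1}$ uniquely from $B_{n,p}$ and $B_{n+1,p}$ (namely $B_{n,p+1}=\frac{p+2}{(p+1)^2}\bigl(pB_{n,p}-B_{n+1,p}\bigr)$), so the family is well defined from the classical Bernoulli numbers $B_{n,0}=B_n$ (with $B_1=-\tfrac12$). The identity is an identity of exponential generating functions: the right-hand side has a removable singularity at $t=0$ and the left-hand side is its Taylor expansion about $t=0$ (equivalently, an identity of formal power series in $t$). -}

module Defs where

open import Data.Nat as ℕ using (ℕ; zero; suc; _∸_; _!)
open import Data.Nat.Properties using (_!≢0)
open import Data.Nat.Combinatorics using (_C_)
open import Data.Integer using (+_)
open import Relation.Binary.PropositionalEquality using (_≡_)
open import Data.Rational using (ℚ; 0ℚ; 1ℚ; _/_; _+_; _*_; _-_; -_)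

⟦_⟧ : ℕ → ℚ
⟦ n ⟧ = + n / 1

Σ< : ℕ → (ℕ → ℚ) → ℚ
Σ< zero    f = 0ℚ
Σ< (suc n) f = Σ< n f + f n

H : ℕ → ℚ
H n = Σ< n (λ i → + 1 / suc i)

invFact : ℕ → ℚ
invFact n = + 1 / (n !)
  where instance _ = n !≢0

-- formal power series in t over ℚ, given by their coefficient sequences
PS : Set
PS = ℕ → ℚ

_⊛_ : PS → PS → PS
(f ⊛ g) n = Σ< (suc n) (λ i → f i * g (n ∸ i))

_⊕_ : PS → PS → PS
(f ⊕ g) n = f n + g n

_·_ : ℚ → PS → PS
(c · f) n = c * f n

const : ℚ → PS
const c zero    = c
const c (suc _) = 0ℚ

X : PS
X 1 = 1ℚ
X _ = 0ℚ

_^_ : PS → ℕ → PS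
f ^ zero  = const 1ℚ
f ^ suc k = f ⊛ (f ^ k)

expS : ℕ → PS
expS a n = ⟦ a ℕ.^ n ⟧ * invFact n

expm1 : PS
expm1 zero    = 0ℚ
expm1 (suc n) = invFact (suc n)

egf : (ℕ → ℚ) → PS
egf b n = b n * invFact n

binom : ℕ → ℕ → ℚ
binom p k = ⟦ p C k ⟧

coeff : ℕ → ℚ
coeff p = + (suc p ℕ.* suc p) / suc (suc p)

-- Hypotheses characterising the p-Bernoulli numbers B n p:
-- (1) B n 0 = B_n classical:  (Σ B_n t^n/n!) · (e^t - 1) = t  as formal power series
IsClassicalBernoulli : (ℕ → ℚ) → Set
IsClassicalBernoulli b = ∀ n → (egf b ⊛ expm1) n ≡ X n

PBernoulliRec : (ℕ → ℕ → ℚ) → Set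
PBernoulliRec B = ∀ n p → B (suc n) p ≡ ⟦ p ⟧ * B n p - coeff p * B n (suc p)

-- Right-hand side of the theorem multiplied by (e^t - 1)^{p+1}:
-- (p+1)(t - H_p) e^{pt} + (p+1) Σ_{k=1}^{p} C(p,k) H_k (e^t-1)^{p-k}
rhsCleared : ℕ → PS
rhsCleared p =
  (⟦ suc p ⟧ · ((X ⊕ const (- H p)) ⊛ expS p))
  ⊕ (⟦ suc p ⟧ · (λ n → Σ< p (λ i → binom p (suc i) * H (suc i) * (expm1 ^ (p ∸ suc i)) n)))

-- Work in the ring of formal power series over ℚ with the derivative D, and let F_p be the
-- exponential generating function of (B_(n,p))_n. The recurrence says coeff p · F_(p+1) = p F_p - F_p′;
-- multiplied by (eᵗ - 1)^(p+2) it becomes coeff p · G_(p+1) = L_p G_p for the cleared left-hand side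
-- G_p = (eᵗ - 1)^(p+1) F_p and an explicit first-order operator L_p. By Pascal's rule the harmonic sum
-- Σ_k C(p,k) H_k (eᵗ - 1)^(p-k) equals H_p e^(pt) - T_p with T_p = Σ_(k=1..p) (eᵗ - 1)^k e^((p-k)t) / k,
-- so the cleared right-hand side is (p+1)(t e^(pt) - T_p). From D T_p = p T_p + e^(pt) - (eᵗ - 1)^p it
-- satisfies the same relation under L_p, and at p = 0 both sides are t by the defining property of the
-- classical Bernoulli numbers. Induction on p, cancelling coeff p ≠ 0, finishes the proof.

module Submission where

open import Defs
open import Data.Nat as ℕ using (ℕ; zero; suc; _∸_; _!; s≤s; z≤n)
import Data.Nat.Properties as ℕP
open import Data.Nat.Combinatorics using (_C_; k>n⇒nCk≡0; nC1≡n; nCk+nC[k+1]≡[n+1]C[k+1])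
import Data.Integer as ℤ
import Data.Integer.Properties as ℤP
open import Data.Rational using (ℚ; 0ℚ; 1ℚ; _/_; _+_; _*_; _-_; -_; toℚᵘ)
import Data.Rational.Properties as ℚP
import Data.Rational.Unnormalised as ℚᵘ
import Data.Rational.Unnormalised.Properties as ℚᵘP
open import Data.Rational.Solver using (module +-*-Solver)
open import Data.Maybe using (Maybe; just; nothing)
open import Data.Product using (_,_)
open import Function using (_⟨_⟩_)
open import Relation.Nullary using (yes; no)
open import Relation.Binary.PropositionalEquality
open import Algebra.Bundles using (CommutativeRing)
open import Algebra.Structures using (IsCommutativeRing)
import Algebra.Solver.Ring
import Algebra.Solver.Ring.AlmostCommutativeRing as ACR
import Relation.Binary.Reasoning.Setoid as SetoidReasoning

open +-*-Solver using (solve; _:=_; _:+_; _:*_; :-_; _:-_; con)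

module _ where
  open ℤ using (+_)

  toℚᵘ-⟦⟧ : ∀ n → toℚᵘ ⟦ n ⟧ ℚᵘ.≃ ℚᵘ.mkℚᵘ (+ n) 0
  toℚᵘ-⟦⟧ n = ℚP.toℚᵘ-fromℚᵘ (ℚᵘ.mkℚᵘ (+ n) 0)

  ⟦⟧-homo-+ : ∀ m n → ⟦ m ℕ.+ n ⟧ ≡ ⟦ m ⟧ + ⟦ n ⟧
  ⟦⟧-homo-+ m n = ℚP.toℚᵘ-injective (begin
    toℚᵘ ⟦ m ℕ.+ n ⟧                      ≈⟨ toℚᵘ-⟦⟧ (m ℕ.+ n) ⟩
    ℚᵘ.mkℚᵘ (+ (m ℕ.+ n)) 0                ≈⟨ ℚᵘ.*≡* (cong (ℤ._* + 1) numerators) ⟩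
    ℚᵘ.mkℚᵘ (+ m) 0 ℚᵘ.+ ℚᵘ.mkℚᵘ (+ n) 0    ≈⟨ ℚᵘP.+-cong (toℚᵘ-⟦⟧ m) (toℚᵘ-⟦⟧ n) ⟨
    toℚᵘ ⟦ m ⟧ ℚᵘ.+ toℚᵘ ⟦ n ⟧              ≈⟨ ℚP.toℚᵘ-homo-+ ⟦ m ⟧ ⟦ n ⟧ ⟨
    toℚᵘ (⟦ m ⟧ + ⟦ n ⟧)                    ∎)
    where
    open ℚᵘP.≃-Reasoning
    numerators : + (m ℕ.+ n) ≡ + m ℤ.* + 1 ℤ.+ + n ℤ.* + 1
    numerators = trans (ℤP.pos-+ m n) (sym (cong₂ ℤ._+_ (ℤP.*-identityʳ (+ m)) (ℤP.*-identityʳ (+ n))))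

  ⟦⟧-homo-* : ∀ m n → ⟦ m ℕ.* n ⟧ ≡ ⟦ m ⟧ * ⟦ n ⟧
  ⟦⟧-homo-* m n = ℚP.toℚᵘ-injective (begin
    toℚᵘ ⟦ m ℕ.* n ⟧                      ≈⟨ toℚᵘ-⟦⟧ (m ℕ.* n) ⟩
    ℚᵘ.mkℚᵘ (+ (m ℕ.* n)) 0                ≈⟨ ℚᵘ.*≡* (cong (ℤ._* + 1) (ℤP.pos-* m n)) ⟩
    ℚᵘ.mkℚᵘ (+ m) 0 ℚᵘ.* ℚᵘ.mkℚᵘ (+ n) 0    ≈⟨ ℚᵘP.*-cong (toℚᵘ-⟦⟧ m) (toℚᵘ-⟦⟧ n) ⟨
    toℚᵘ ⟦ m ⟧ ℚᵘ.* toℚᵘ ⟦ n ⟧              ≈⟨ ℚP.toℚᵘ-homo-* ⟦ m ⟧ ⟦ n ⟧ ⟨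
    toℚᵘ (⟦ m ⟧ * ⟦ n ⟧)                    ∎)
    where open ℚᵘP.≃-Reasoning

  a/d*d≡a : ∀ a d .{{_ : ℕ.NonZero d}} → (+ a / d) * ⟦ d ⟧ ≡ ⟦ a ⟧
  a/d*d≡a a d@(suc d-1) = ℚP.toℚᵘ-injective (begin
    toℚᵘ ((+ a / d) * ⟦ d ⟧)                   ≈⟨ ℚP.toℚᵘ-homo-* (+ a / d) ⟦ d ⟧ ⟩
    toℚᵘ (+ a / d) ℚᵘ.* toℚᵘ ⟦ d ⟧              ≈⟨ ℚᵘP.*-cong (ℚP.toℚᵘ-fromℚᵘ (ℚᵘ.mkℚᵘ (+ a) d-1)) (toℚᵘ-⟦⟧ d) ⟩
    ℚᵘ.mkℚᵘ (+ a) d-1 ℚᵘ.* ℚᵘ.mkℚᵘ (+ d) 0      ≈⟨ ℚᵘ.*≡* cross ⟩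
    ℚᵘ.mkℚᵘ (+ a) 0                            ≈⟨ toℚᵘ-⟦⟧ a ⟨
    toℚᵘ ⟦ a ⟧                                 ∎)
    where
    open ℚᵘP.≃-Reasoning
    cross : (+ a ℤ.* + d) ℤ.* + 1 ≡ + a ℤ.* + (d ℕ.* 1)
    cross = trans (ℤP.*-identityʳ _) (cong (λ z → + a ℤ.* + z) (sym (ℕP.*-identityʳ d)))

  *-cancelʳ-⟦⟧ : ∀ d .{{_ : ℕ.NonZero d}} {x y : ℚ} → x * ⟦ d ⟧ ≡ y * ⟦ d ⟧ → x ≡ y
  *-cancelʳ-⟦⟧ d {x} {y} eq = begin
    x                          ≡⟨ undo x ⟨
    (x * ⟦ d ⟧) * (+ 1 / d)    ≡⟨ cong (_* (+ 1 / d)) eq ⟩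
    (y * ⟦ d ⟧) * (+ 1 / d)    ≡⟨ undo y ⟩
    y                          ∎
    where
    open ≡-Reasoning
    undo : ∀ z → (z * ⟦ d ⟧) * (+ 1 / d) ≡ z
    undo z = begin
      (z * ⟦ d ⟧) * (+ 1 / d)  ≡⟨ solve 3 (λ a b c → (a :* b) :* c := a :* (c :* b)) refl z ⟦ d ⟧ (+ 1 / d) ⟩
      z * ((+ 1 / d) * ⟦ d ⟧)  ≡⟨ cong (z *_) (a/d*d≡a 1 d) ⟩
      z * 1ℚ                   ≡⟨ ℚP.*-identityʳ z ⟩
      z                        ∎

  inv : ℕ → ℚ
  inv i = + 1 / suc i

  inv*⟦suc⟧≡1 : ∀ i → inv i * ⟦ suc i ⟧ ≡ 1ℚ
  inv*⟦suc⟧≡1 i = a/d*d≡a 1 (suc i)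

invFact-suc : ∀ n → ⟦ suc n ⟧ * invFact (suc n) ≡ invFact n
invFact-suc n = *-cancelʳ-⟦⟧ (n !) {{n ℕP.!≢0}} (begin
  (⟦ suc n ⟧ * invFact (suc n)) * ⟦ n ! ⟧   ≡⟨ solve 3 (λ a b c → (a :* b) :* c := b :* (a :* c)) refl ⟦ suc n ⟧ (invFact (suc n)) ⟦ n ! ⟧ ⟩
  invFact (suc n) * (⟦ suc n ⟧ * ⟦ n ! ⟧)   ≡⟨ cong (invFact (suc n) *_) (⟦⟧-homo-* (suc n) (n !)) ⟨
  invFact (suc n) * ⟦ suc n ! ⟧             ≡⟨ a/d*d≡a 1 (suc n !) {{suc n ℕP.!≢0}} ⟩
  1ℚ                                        ≡⟨ a/d*d≡a 1 (n !) {{n ℕP.!≢0}} ⟨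
  invFact n * ⟦ n ! ⟧                       ∎)
  where open ≡-Reasoning

coeff*⟦2+p⟧ : ∀ p → coeff p * ⟦ suc (suc p) ⟧ ≡ ⟦ suc p ⟧ * ⟦ suc p ⟧
coeff*⟦2+p⟧ p = trans (a/d*d≡a (suc p ℕ.* suc p) (suc (suc p))) (⟦⟧-homo-* (suc p) (suc p))

*-cancelˡ-coeff : ∀ p {x y} → coeff p * x ≡ coeff p * y → x ≡ y
*-cancelˡ-coeff p {x} {y} eq = *-cancelʳ-⟦⟧ (suc p) (*-cancelʳ-⟦⟧ (suc p) (begin
  (x * ⟦ suc p ⟧) * ⟦ suc p ⟧       ≡⟨ cleared x ⟩
  (coeff p * x) * ⟦ suc (suc p) ⟧   ≡⟨ cong (_* ⟦ suc (suc p) ⟧) eq ⟩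
  (coeff p * y) * ⟦ suc (suc p) ⟧   ≡⟨ cleared y ⟨
  (y * ⟦ suc p ⟧) * ⟦ suc p ⟧       ∎))
  where
  open ≡-Reasoning
  cleared : ∀ z → (z * ⟦ suc p ⟧) * ⟦ suc p ⟧ ≡ (coeff p * z) * ⟦ suc (suc p) ⟧
  cleared z = begin
    (z * ⟦ suc p ⟧) * ⟦ suc p ⟧       ≡⟨ ℚP.*-assoc z ⟦ suc p ⟧ ⟦ suc p ⟧ ⟩
    z * (⟦ suc p ⟧ * ⟦ suc p ⟧)        ≡⟨ cong (z *_) (coeff*⟦2+p⟧ p) ⟨
    z * (coeff p * ⟦ suc (suc p) ⟧)    ≡⟨ solve 3 (λ a b c → a :* (b :* c) := (b :* a) :* c) refl z (coeff p) ⟦ suc (suc p) ⟧ ⟩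
    (coeff p * z) * ⟦ suc (suc p) ⟧    ∎

Σ<-cong : ∀ n {f g : ℕ → ℚ} → (∀ i → f i ≡ g i) → Σ< n f ≡ Σ< n g
Σ<-cong zero    eq = refl
Σ<-cong (suc n) eq = cong₂ _+_ (Σ<-cong n eq) (eq n)

Σ<-cong-< : ∀ n {f g : ℕ → ℚ} → (∀ i → i ℕ.< n → f i ≡ g i) → Σ< n f ≡ Σ< n g
Σ<-cong-< zero    eq = refl
Σ<-cong-< (suc n) eq = cong₂ _+_ (Σ<-cong-< n (λ i i<n → eq i (ℕP.m<n⇒m<1+n i<n))) (eq n (ℕP.n<1+n n))

Σ<-+ : ∀ n (f g : ℕ → ℚ) → Σ< n (λ i → f i + g i) ≡ Σ< n f + Σ< n g
Σ<-+ zero    f g = refl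
Σ<-+ (suc n) f g = trans (cong (_+ (f n + g n)) (Σ<-+ n f g))
  (solve 4 (λ a b c d → (a :+ b) :+ (c :+ d) := (a :+ c) :+ (b :+ d)) refl (Σ< n f) (Σ< n g) (f n) (g n))

Σ<-*ˡ : ∀ n c (f : ℕ → ℚ) → Σ< n (λ i → c * f i) ≡ c * Σ< n f
Σ<-*ˡ zero    c f = sym (ℚP.*-zeroʳ c)
Σ<-*ˡ (suc n) c f = trans (cong (_+ (c * f n)) (Σ<-*ˡ n c f)) (sym (ℚP.*-distribˡ-+ c (Σ< n f) (f n)))

Σ<-zero : ∀ n {f : ℕ → ℚ} → (∀ i → f i ≡ 0ℚ) → Σ< n f ≡ 0ℚ
Σ<-zero zero    eq = refl
Σ<-zero (suc n) eq = trans (cong₂ _+_ (Σ<-zero n eq) (eq n)) (ℚP.+-identityˡ 0ℚ)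

Σ<-suc-first : ∀ n (f : ℕ → ℚ) → Σ< (suc n) f ≡ f 0 + Σ< n (λ i → f (suc i))
Σ<-suc-first zero    f = sym (ℚP.+-comm (f 0) 0ℚ)
Σ<-suc-first (suc n) f = trans (cong (_+ f (suc n)) (Σ<-suc-first n f)) (ℚP.+-assoc (f 0) _ _)

-- The ring of formal power series

infix 4 _≈_
_≈_ : PS → PS → Set
f ≈ g = ∀ n → f n ≡ g n

⊖_ : PS → PS
(⊖ f) n = - f n

0ₛ 1ₛ : PS
0ₛ = const 0ℚ
1ₛ = const 1ℚ

shift : PS → PS
shift f n = f (suc n)

const0≡0 : ∀ n → const 0ℚ n ≡ 0ℚ
const0≡0 zero    = refl
const0≡0 (suc n) = refl

⊛-suc : ∀ f g n → (f ⊛ g) (suc n) ≡ f 0 * g (suc n) + (shift f ⊛ g) n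
⊛-suc f g n = Σ<-suc-first (suc n) (λ i → f i * g (suc n ∸ i))

⊛-zeroˡ : ∀ f n → ((λ _ → 0ℚ) ⊛ f) n ≡ 0ℚ
⊛-zeroˡ f n = Σ<-zero (suc n) (λ i → ℚP.*-zeroˡ (f (n ∸ i)))

⊛-comm : ∀ n f g → (f ⊛ g) n ≡ (g ⊛ f) n
⊛-comm zero          f g = cong (0ℚ +_) (ℚP.*-comm (f 0) (g 0))
⊛-comm (suc zero)    f g =
  solve 4 (λ a b c d → (con 0ℚ :+ a :* d) :+ b :* c := (con 0ℚ :+ c :* b) :+ d :* a) refl (f 0) (f 1) (g 0) (g 1)
⊛-comm (suc (suc m)) f g = begin
  (f ⊛ g) (suc (suc m))                                      ≡⟨ ⊛-suc f g (suc m) ⟩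
  f 0 * g (2 ℕ.+ m) + (shift f ⊛ g) (suc m)
    ≡⟨ cong (f 0 * g (2 ℕ.+ m) +_) (⊛-comm (suc m) (shift f) g ⟨ trans ⟩ ⊛-suc g (shift f) m) ⟩
  f 0 * g (2 ℕ.+ m) + (g 0 * f (2 ℕ.+ m) + (shift g ⊛ shift f) m)
    ≡⟨ cong (λ z → f 0 * g (2 ℕ.+ m) + (g 0 * f (2 ℕ.+ m) + z)) (⊛-comm m (shift g) (shift f)) ⟩
  f 0 * g (2 ℕ.+ m) + (g 0 * f (2 ℕ.+ m) + (shift f ⊛ shift g) m)
    ≡⟨ solve 3 (λ a b c → a :+ (b :+ c) := b :+ (a :+ c)) refl (f 0 * g (2 ℕ.+ m)) (g 0 * f (2 ℕ.+ m)) ((shift f ⊛ shift g) m) ⟩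
  g 0 * f (2 ℕ.+ m) + (f 0 * g (2 ℕ.+ m) + (shift f ⊛ shift g) m)
    ≡⟨ cong (g 0 * f (2 ℕ.+ m) +_) (⊛-comm (suc m) (shift g) f ⟨ trans ⟩ ⊛-suc f (shift g) m) ⟨
  g 0 * f (2 ℕ.+ m) + (shift g ⊛ f) (suc m)                  ≡⟨ ⊛-suc g f (suc m) ⟨
  (g ⊛ f) (suc (suc m))                                      ∎
  where open ≡-Reasoning

⊛-distribʳ : ∀ f g h n → ((f ⊕ g) ⊛ h) n ≡ (f ⊛ h) n + (g ⊛ h) n
⊛-distribʳ f g h n = trans (Σ<-cong (suc n) (λ i → ℚP.*-distribʳ-+ (h (n ∸ i)) (f i) (g i))) (Σ<-+ (suc n) _ _)

⊛-·ˡ : ∀ c f g n → ((c · f) ⊛ g) n ≡ c * (f ⊛ g) n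
⊛-·ˡ c f g n = trans (Σ<-cong (suc n) (λ i → ℚP.*-assoc c (f i) (g (n ∸ i)))) (Σ<-*ˡ (suc n) c _)

⊛-·ʳ : ∀ f c g n → (f ⊛ (c · g)) n ≡ c * (f ⊛ g) n
⊛-·ʳ f c g n = ⊛-comm n f (c · g) ⟨ trans ⟩ (⊛-·ˡ c g f n ⟨ trans ⟩ cong (c *_) (⊛-comm n g f))

⊛-congʳ : ∀ {f f′} g → f ≈ f′ → (f ⊛ g) ≈ (f′ ⊛ g)
⊛-congʳ g eq n = Σ<-cong (suc n) (λ i → cong (_* g (n ∸ i)) (eq i))

⊛-cong : ∀ {f f′ g g′} → f ≈ f′ → g ≈ g′ → (f ⊛ g) ≈ (f′ ⊛ g′)
⊛-cong {f} {f′} {g} {g′} f≈f′ g≈g′ n =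
  ⊛-congʳ g f≈f′ n ⟨ trans ⟩ (⊛-comm n f′ g ⟨ trans ⟩ (⊛-congʳ f′ g≈g′ n ⟨ trans ⟩ ⊛-comm n g′ f′))

⊛-congˡ : ∀ f {g g′} → g ≈ g′ → (f ⊛ g) ≈ (f ⊛ g′)
⊛-congˡ f = ⊛-cong {f} {f} (λ n → refl)

⊛-const : ∀ c f n → (const c ⊛ f) n ≡ c * f n
⊛-const c f zero    = ℚP.+-identityˡ _
⊛-const c f (suc n) = ⊛-suc (const c) f n ⟨ trans ⟩ (cong (c * f (suc n) +_) (⊛-zeroˡ f n) ⟨ trans ⟩ ℚP.+-identityʳ _)

⊛-assoc : ∀ n f g h → ((f ⊛ g) ⊛ h) n ≡ (f ⊛ (g ⊛ h)) n
⊛-assoc zero    f g h =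
  solve 3 (λ a b c → con 0ℚ :+ (con 0ℚ :+ a :* b) :* c := con 0ℚ :+ a :* (con 0ℚ :+ b :* c)) refl (f 0) (g 0) (h 0)
⊛-assoc (suc n) f g h = begin
  ((f ⊛ g) ⊛ h) (suc n)                                    ≡⟨ ⊛-suc (f ⊛ g) h n ⟩
  (f ⊛ g) 0 * h (suc n) + (shift (f ⊛ g) ⊛ h) n             ≡⟨ cong (fg0h +_) (⊛-congʳ h (⊛-suc f g) n) ⟩
  (f ⊛ g) 0 * h (suc n) + (((f 0 · shift g) ⊕ (shift f ⊛ g)) ⊛ h) n
    ≡⟨ cong (fg0h +_) (⊛-distribʳ (f 0 · shift g) (shift f ⊛ g) h n ⟨ trans ⟩
                       cong₂ _+_ (⊛-·ˡ (f 0) (shift g) h n) (⊛-assoc n (shift f) g h)) ⟩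
  (f ⊛ g) 0 * h (suc n) + (f 0 * (shift g ⊛ h) n + (shift f ⊛ (g ⊛ h)) n)
    ≡⟨ solve 5 (λ a b c d e → (con 0ℚ :+ a :* b) :* c :+ (a :* d :+ e) := a :* (b :* c :+ d) :+ e)
         refl (f 0) (g 0) (h (suc n)) ((shift g ⊛ h) n) ((shift f ⊛ (g ⊛ h)) n) ⟩
  f 0 * (g 0 * h (suc n) + (shift g ⊛ h) n) + (shift f ⊛ (g ⊛ h)) n
    ≡⟨ cong (λ z → f 0 * z + (shift f ⊛ (g ⊛ h)) n) (⊛-suc g h n) ⟨
  f 0 * (g ⊛ h) (suc n) + (shift f ⊛ (g ⊛ h)) n              ≡⟨ ⊛-suc f (g ⊛ h) n ⟨
  (f ⊛ (g ⊛ h)) (suc n)                                     ∎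
  where
  open ≡-Reasoning
  fg0h = (f ⊛ g) 0 * h (suc n)

⊛-isCommutativeRing : IsCommutativeRing _≈_ _⊕_ _⊛_ ⊖_ 0ₛ 1ₛ
⊛-isCommutativeRing = record
  { isRing = record
    { +-isAbelianGroup = record
      { isGroup = record
        { isMonoid = record
          { isSemigroup = record
            { isMagma = record
              { isEquivalence = record
                { refl  = λ n → refl
                ; sym   = λ f≈g n → sym (f≈g n)
                ; trans = λ f≈g g≈h n → trans (f≈g n) (g≈h n)
                }
              ; ∙-cong = λ f≈f′ g≈g′ n → cong₂ _+_ (f≈f′ n) (g≈g′ n)
              }
            ; assoc = λ f g h n → ℚP.+-assoc (f n) (g n) (h n)
            }
          ; identity = (λ f n → cong (_+ f n) (const0≡0 n) ⟨ trans ⟩ ℚP.+-identityˡ (f n))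
                     , (λ f n → cong (f n +_) (const0≡0 n) ⟨ trans ⟩ ℚP.+-identityʳ (f n))
          }
        ; inverse = (λ f n → ℚP.+-inverseˡ (f n) ⟨ trans ⟩ sym (const0≡0 n))
                  , (λ f n → ℚP.+-inverseʳ (f n) ⟨ trans ⟩ sym (const0≡0 n))
        ; ⁻¹-cong = λ f≈g n → cong -_ (f≈g n)
        }
      ; comm = λ f g n → ℚP.+-comm (f n) (g n)
      }
    ; *-cong = ⊛-cong
    ; *-assoc = λ f g h n → ⊛-assoc n f g h
    ; *-identity = (λ f n → ⊛-const 1ℚ f n ⟨ trans ⟩ ℚP.*-identityˡ (f n))
                 , (λ f n → ⊛-comm n f 1ₛ ⟨ trans ⟩ (⊛-const 1ℚ f n ⟨ trans ⟩ ℚP.*-identityˡ (f n)))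
    ; distrib = (λ f g h n → ⊛-comm n f (g ⊕ h) ⟨ trans ⟩ (⊛-distribʳ g h f n ⟨ trans ⟩ cong₂ _+_ (⊛-comm n g f) (⊛-comm n h f)))
              , (λ f g h n → ⊛-distribʳ g h f n)
    }
  ; *-comm = λ f g n → ⊛-comm n f g
  }

powerSeriesRing : CommutativeRing _ _
powerSeriesRing = record { isCommutativeRing = ⊛-isCommutativeRing }

open CommutativeRing powerSeriesRing using ()
  renaming (setoid to ≈-setoid; refl to ≈-refl; sym to ≈-sym; trans to ≈-trans; +-cong to ⊕-cong; -‿cong to ⊖-cong)

⊕-congˡ : ∀ f {g g′} → g ≈ g′ → (f ⊕ g) ≈ (f ⊕ g′)
⊕-congˡ f = ⊕-cong {f} {f} ≈-refl

⊕-congʳ : ∀ {f f′} g → f ≈ f′ → (f ⊕ g) ≈ (f′ ⊕ g)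
⊕-congʳ g f≈f′ = ⊕-cong f≈f′ (≈-refl {g})

module ≈-Reasoning = SetoidReasoning ≈-setoid

const-+ : ∀ a b → const (a + b) ≈ (const a ⊕ const b)
const-+ a b zero    = refl
const-+ a b (suc n) = refl

·≈const⊛ : ∀ c f → (c · f) ≈ (const c ⊛ f)
·≈const⊛ c f n = sym (⊛-const c f n)

const-neg : ∀ a → const (- a) ≈ (⊖ const a)
const-neg a zero    = refl
const-neg a (suc n) = refl

const-⊛ : ∀ a b → (const a ⊛ const b) ≈ const (a * b)
const-⊛ a b zero    = ⊛-const a (const b) zero
const-⊛ a b (suc n) = trans (⊛-const a (const b) (suc n)) (ℚP.*-zeroʳ a)

const-homo : ACR._-Raw-AlmostCommutative⟶_ ℚP.+-*-rawRing (ACR.fromCommutativeRing powerSeriesRing)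
const-homo = record
  { ⟦_⟧    = const
  ; +-homo = const-+
  ; *-homo = λ a b → ≈-sym (const-⊛ a b)
  ; -‿homo = const-neg
  ; 0-homo = ≈-refl
  ; 1-homo = ≈-refl
  }

const-≟ : ∀ a b → Maybe (const a ≈ const b)
const-≟ a b with a ℚP.≟ b
... | yes a≡b = just (λ n → cong (λ c → const c n) a≡b)
... | no  _   = nothing

module PowerSeriesSolver =
  Algebra.Solver.Ring ℚP.+-*-rawRing (ACR.fromCommutativeRing powerSeriesRing) const-homo const-≟
open PowerSeriesSolver using ()
  renaming (solve to ring; _:=_ to _:=ₛ_; _:+_ to _:+ₛ_; _:*_ to _:*ₛ_; :-_ to :-ₛ_; _:-_ to _:-ₛ_; con to conₛ)

⟦_⟧ₛ : ℕ → PS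
⟦ n ⟧ₛ = const ⟦ n ⟧

⟦suc⟧ₛ : ∀ k → ⟦ suc k ⟧ₛ ≈ (⟦ k ⟧ₛ ⊕ 1ₛ)
⟦suc⟧ₛ k zero    = ⟦⟧-homo-+ 1 k ⟨ trans ⟩ ℚP.+-comm ⟦ 1 ⟧ ⟦ k ⟧
⟦suc⟧ₛ k (suc n) = refl

inv-cancel : ∀ p f → (const (inv p) ⊛ (⟦ suc p ⟧ₛ ⊛ f)) ≈ f
inv-cancel p f n = begin
  (const (inv p) ⊛ (⟦ suc p ⟧ₛ ⊛ f)) n   ≡⟨ trans (⊛-const (inv p) (⟦ suc p ⟧ₛ ⊛ f) n) (cong (inv p *_) (⊛-const ⟦ suc p ⟧ f n)) ⟩
  inv p * (⟦ suc p ⟧ * f n)             ≡⟨ ℚP.*-assoc (inv p) ⟦ suc p ⟧ (f n) ⟨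
  (inv p * ⟦ suc p ⟧) * f n             ≡⟨ cong (_* f n) (inv*⟦suc⟧≡1 p) ⟩
  1ℚ * f n                              ≡⟨ ℚP.*-identityˡ (f n) ⟩
  f n                                   ∎
  where open ≡-Reasoning

-- The derivative

-- Leibniz's rule is easiest for the Euler operator θ = t d/dt, where it is n = i + (n - i) termwise.
θ : PS → PS
θ f n = ⟦ n ⟧ * f n

D : PS → PS
D f n = ⟦ suc n ⟧ * f (suc n)

θ-⊛ : ∀ f g → θ (f ⊛ g) ≈ ((θ f ⊛ g) ⊕ (f ⊛ θ g))
θ-⊛ f g n = sym (Σ<-*ˡ (suc n) ⟦ n ⟧ _) ⟨ trans ⟩ (Σ<-cong-< (suc n) split ⟨ trans ⟩ Σ<-+ (suc n) _ _)
  where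
  split : ∀ i → i ℕ.< suc n →
          ⟦ n ⟧ * (f i * g (n ∸ i)) ≡ (⟦ i ⟧ * f i) * g (n ∸ i) + f i * (⟦ n ∸ i ⟧ * g (n ∸ i))
  split i i<1+n = begin
    ⟦ n ⟧ * (f i * g (n ∸ i))                  ≡⟨ cong (λ k → ⟦ k ⟧ * (f i * g (n ∸ i))) (ℕP.m+[n∸m]≡n (ℕ.s≤s⁻¹ i<1+n)) ⟨
    ⟦ i ℕ.+ (n ∸ i) ⟧ * (f i * g (n ∸ i))      ≡⟨ cong (_* (f i * g (n ∸ i))) (⟦⟧-homo-+ i (n ∸ i)) ⟩
    (⟦ i ⟧ + ⟦ n ∸ i ⟧) * (f i * g (n ∸ i))
      ≡⟨ solve 4 (λ a b x y → (a :+ b) :* (x :* y) := (a :* x) :* y :+ x :* (b :* y)) refl ⟦ i ⟧ ⟦ n ∸ i ⟧ (f i) (g (n ∸ i)) ⟩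
    (⟦ i ⟧ * f i) * g (n ∸ i) + f i * (⟦ n ∸ i ⟧ * g (n ∸ i)) ∎
    where open ≡-Reasoning

θ⊛-suc : ∀ f g n → (θ f ⊛ g) (suc n) ≡ (D f ⊛ g) n
θ⊛-suc f g n = ⊛-suc (θ f) g n ⟨ trans ⟩ (cong (_+ (D f ⊛ g) n) vanishes ⟨ trans ⟩ ℚP.+-identityˡ _)
  where
  vanishes : (⟦ 0 ⟧ * f 0) * g (suc n) ≡ 0ℚ
  vanishes = cong (_* g (suc n)) (ℚP.*-zeroˡ (f 0)) ⟨ trans ⟩ ℚP.*-zeroˡ (g (suc n))

D-⊛ : ∀ f g → D (f ⊛ g) ≈ ((D f ⊛ g) ⊕ (f ⊛ D g))
D-⊛ f g n = θ-⊛ f g (suc n) ⟨ trans ⟩ cong₂ _+_ (θ⊛-suc f g n) θ-right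
  where
  θ-right : (f ⊛ θ g) (suc n) ≡ (f ⊛ D g) n
  θ-right = ⊛-comm (suc n) f (θ g) ⟨ trans ⟩ (θ⊛-suc g f n ⟨ trans ⟩ ⊛-comm n (D g) f)

D-cong : ∀ {f g} → f ≈ g → D f ≈ D g
D-cong f≈g n = cong (⟦ suc n ⟧ *_) (f≈g (suc n))

D-⊕ : ∀ f g → D (f ⊕ g) ≈ (D f ⊕ D g)
D-⊕ f g n = ℚP.*-distribˡ-+ ⟦ suc n ⟧ (f (suc n)) (g (suc n))

D-⊖ : ∀ f → D (⊖ f) ≈ (⊖ D f)
D-⊖ f n = sym (ℚP.neg-distribʳ-* ⟦ suc n ⟧ (f (suc n)))

D-const : ∀ c → D (const c) ≈ 0ₛ
D-const c n = ℚP.*-zeroʳ ⟦ suc n ⟧ ⟨ trans ⟩ sym (const0≡0 n)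

D-X : D X ≈ 1ₛ
D-X zero    = refl
D-X (suc n) = ℚP.*-zeroʳ ⟦ 2 ℕ.+ n ⟧

D-const⊛ : ∀ c f → D (const c ⊛ f) ≈ (const c ⊛ D f)
D-const⊛ c f = begin
  D (const c ⊛ f)                          ≈⟨ D-⊛ (const c) f ⟩
  ((D (const c) ⊛ f) ⊕ (const c ⊛ D f))    ≈⟨ ⊕-congʳ (const c ⊛ D f) (⊛-congʳ f (D-const c)) ⟩
  ((0ₛ ⊛ f) ⊕ (const c ⊛ D f))             ≈⟨ ring 2 (λ a b → conₛ 0ℚ :*ₛ a :+ₛ b :=ₛ b) ≈-refl f (const c ⊛ D f) ⟩
  (const c ⊛ D f)                          ∎
  where open ≈-Reasoning

D-^ : ∀ f k → D (f ^ suc k) ≈ (⟦ suc k ⟧ₛ ⊛ ((f ^ k) ⊛ D f))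
D-^ f zero = begin
  D (f ⊛ 1ₛ)                      ≈⟨ D-⊛ f 1ₛ ⟩
  ((D f ⊛ 1ₛ) ⊕ (f ⊛ D 1ₛ))       ≈⟨ ⊕-congˡ (D f ⊛ 1ₛ) (⊛-congˡ f (D-const 1ℚ)) ⟩
  ((D f ⊛ 1ₛ) ⊕ (f ⊛ 0ₛ))         ≈⟨ ring 2 (λ d a → d :*ₛ conₛ 1ℚ :+ₛ a :*ₛ conₛ 0ℚ :=ₛ conₛ 1ℚ :*ₛ (conₛ 1ℚ :*ₛ d)) ≈-refl (D f) f ⟩
  (⟦ 1 ⟧ₛ ⊛ (1ₛ ⊛ D f))           ∎
  where open ≈-Reasoning
D-^ f (suc k) = begin
  D (f ⊛ (f ^ suc k))                                    ≈⟨ D-⊛ f (f ^ suc k) ⟩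
  ((D f ⊛ (f ^ suc k)) ⊕ (f ⊛ D (f ^ suc k)))            ≈⟨ ⊕-congˡ (D f ⊛ (f ^ suc k)) (⊛-congˡ f (D-^ f k)) ⟩
  ((D f ⊛ (f ⊛ (f ^ k))) ⊕ (f ⊛ (⟦ suc k ⟧ₛ ⊛ ((f ^ k) ⊛ D f))))
    ≈⟨ ring 4 (λ a b d c → d :*ₛ (a :*ₛ b) :+ₛ a :*ₛ (c :*ₛ (b :*ₛ d)) :=ₛ (c :+ₛ conₛ 1ℚ) :*ₛ ((a :*ₛ b) :*ₛ d))
         ≈-refl f (f ^ k) (D f) ⟦ suc k ⟧ₛ ⟩
  ((⟦ suc k ⟧ₛ ⊕ 1ₛ) ⊛ ((f ^ suc k) ⊛ D f))              ≈⟨ ⊛-congʳ ((f ^ suc k) ⊛ D f) (⟦suc⟧ₛ (suc k)) ⟨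
  (⟦ suc (suc k) ⟧ₛ ⊛ ((f ^ suc k) ⊛ D f))               ∎
  where open ≈-Reasoning

D≈⊛-unique : ∀ c f g → D f ≈ (const c ⊛ f) → D g ≈ (const c ⊛ g) → f 0 ≡ g 0 → f ≈ g
D≈⊛-unique c f g f′≈cf g′≈cg f0≡g0 zero    = f0≡g0
D≈⊛-unique c f g f′≈cf g′≈cg f0≡g0 (suc n) = *-cancelʳ-⟦⟧ (suc n) (begin
  f (suc n) * ⟦ suc n ⟧   ≡⟨ ℚP.*-comm (f (suc n)) ⟦ suc n ⟧ ⟩
  D f n                   ≡⟨ trans (f′≈cf n) (⊛-const c f n) ⟩
  c * f n                 ≡⟨ cong (c *_) (D≈⊛-unique c f g f′≈cf g′≈cg f0≡g0 n) ⟩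
  c * g n                 ≡⟨ trans (g′≈cg n) (⊛-const c g n) ⟨
  D g n                   ≡⟨ ℚP.*-comm ⟦ suc n ⟧ (g (suc n)) ⟩
  g (suc n) * ⟦ suc n ⟧   ∎)
  where open ≡-Reasoning

-- Exponentials

eᵗ : PS
eᵗ = expm1 ⊕ 1ₛ

D-expm1 : D expm1 ≈ eᵗ
D-expm1 zero    = invFact-suc 0
D-expm1 (suc n) = invFact-suc (suc n) ⟨ trans ⟩ sym (ℚP.+-identityʳ _)

D-eᵗ : D eᵗ ≈ eᵗ
D-eᵗ = begin
  D eᵗ               ≈⟨ D-⊕ expm1 1ₛ ⟩
  (D expm1 ⊕ D 1ₛ)   ≈⟨ ⊕-cong D-expm1 (D-const 1ℚ) ⟩
  (eᵗ ⊕ 0ₛ)          ≈⟨ ring 1 (λ a → a :+ₛ conₛ 0ℚ :=ₛ a) ≈-refl eᵗ ⟩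
  eᵗ                 ∎
  where open ≈-Reasoning

D-eᵗ^ : ∀ p → D (eᵗ ^ p) ≈ (⟦ p ⟧ₛ ⊛ (eᵗ ^ p))
D-eᵗ^ zero    = ≈-trans (D-const 1ℚ) (ring 1 (λ a → conₛ 0ℚ :=ₛ conₛ 0ℚ :*ₛ a) ≈-refl 1ₛ)
D-eᵗ^ (suc k) = begin
  D (eᵗ ^ suc k)                            ≈⟨ D-^ eᵗ k ⟩
  (⟦ suc k ⟧ₛ ⊛ ((eᵗ ^ k) ⊛ D eᵗ))          ≈⟨ ⊛-congˡ ⟦ suc k ⟧ₛ (⊛-congˡ (eᵗ ^ k) D-eᵗ) ⟩
  (⟦ suc k ⟧ₛ ⊛ ((eᵗ ^ k) ⊛ eᵗ))            ≈⟨ ring 3 (λ c a b → c :*ₛ (a :*ₛ b) :=ₛ c :*ₛ (b :*ₛ a)) ≈-refl ⟦ suc k ⟧ₛ (eᵗ ^ k) eᵗ ⟩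
  (⟦ suc k ⟧ₛ ⊛ (eᵗ ^ suc k))               ∎
  where open ≈-Reasoning

D-expS : ∀ p → D (expS p) ≈ (⟦ p ⟧ₛ ⊛ expS p)
D-expS p n = begin
  ⟦ suc n ⟧ * (⟦ p ℕ.* p ℕ.^ n ⟧ * invFact (suc n))
    ≡⟨ cong (λ z → ⟦ suc n ⟧ * (z * invFact (suc n))) (⟦⟧-homo-* p (p ℕ.^ n)) ⟩
  ⟦ suc n ⟧ * ((⟦ p ⟧ * ⟦ p ℕ.^ n ⟧) * invFact (suc n))
    ≡⟨ solve 4 (λ a b c d → a :* ((b :* c) :* d) := b :* (c :* (a :* d))) refl ⟦ suc n ⟧ ⟦ p ⟧ ⟦ p ℕ.^ n ⟧ (invFact (suc n)) ⟩
  ⟦ p ⟧ * (⟦ p ℕ.^ n ⟧ * (⟦ suc n ⟧ * invFact (suc n)))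
    ≡⟨ cong (λ z → ⟦ p ⟧ * (⟦ p ℕ.^ n ⟧ * z)) (invFact-suc n) ⟩
  ⟦ p ⟧ * expS p n
    ≡⟨ ⊛-const ⟦ p ⟧ (expS p) n ⟨
  (⟦ p ⟧ₛ ⊛ expS p) n ∎
  where open ≡-Reasoning

eᵗ^-at-0 : ∀ p → (eᵗ ^ p) 0 ≡ 1ℚ
eᵗ^-at-0 zero    = refl
eᵗ^-at-0 (suc p) = cong (λ z → 0ℚ + eᵗ 0 * z) (eᵗ^-at-0 p)

expS≈eᵗ^ : ∀ p → expS p ≈ (eᵗ ^ p)
expS≈eᵗ^ p = D≈⊛-unique ⟦ p ⟧ (expS p) (eᵗ ^ p) (D-expS p) (D-eᵗ^ p) (sym (eᵗ^-at-0 p))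

inv·D-expm1^ : ∀ p → (const (inv p) ⊛ D (expm1 ^ suc p)) ≈ ((expm1 ^ p) ⊛ eᵗ)
inv·D-expm1^ p = ≈-trans (⊛-congˡ (const (inv p)) (≈-trans (D-^ expm1 p) (⊛-congˡ ⟦ suc p ⟧ₛ (⊛-congˡ (expm1 ^ p) D-expm1))))
  (inv-cancel p ((expm1 ^ p) ⊛ eᵗ))

-- Binomial expansions in powers of eᵗ - 1

[1+k]*[1+p]C[1+k]≡[1+p]*pCk : ∀ p k → suc k ℕ.* (suc p C suc k) ≡ suc p ℕ.* (p C k)
[1+k]*[1+p]C[1+k]≡[1+p]*pCk zero    zero    = refl
[1+k]*[1+p]C[1+k]≡[1+p]*pCk zero    (suc k) = begin
  (2 ℕ.+ k) ℕ.* (1 C (2 ℕ.+ k))  ≡⟨ cong ((2 ℕ.+ k) ℕ.*_) (k>n⇒nCk≡0 {1} {2 ℕ.+ k} (s≤s (s≤s z≤n))) ⟩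
  (2 ℕ.+ k) ℕ.* 0                ≡⟨ ℕP.*-zeroʳ (2 ℕ.+ k) ⟩
  0                              ≡⟨ cong (1 ℕ.*_) (k>n⇒nCk≡0 {0} {suc k} (s≤s z≤n)) ⟨
  1 ℕ.* (0 C suc k)              ∎
  where open ≡-Reasoning
[1+k]*[1+p]C[1+k]≡[1+p]*pCk (suc p) zero    =
  trans (ℕP.*-identityˡ _) (trans (nC1≡n (2 ℕ.+ p)) (sym (ℕP.*-identityʳ (2 ℕ.+ p))))
[1+k]*[1+p]C[1+k]≡[1+p]*pCk (suc p) (suc k) = begin
  (2 ℕ.+ k) ℕ.* ((2 ℕ.+ p) C (2 ℕ.+ k))                ≡⟨ cong ((2 ℕ.+ k) ℕ.*_) (nCk+nC[k+1]≡[n+1]C[k+1] (suc p) (suc k)) ⟨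
  (2 ℕ.+ k) ℕ.* (c ℕ.+ d)                              ≡⟨ ℕP.*-distribˡ-+ (2 ℕ.+ k) c d ⟩
  c ℕ.+ suc k ℕ.* c ℕ.+ (2 ℕ.+ k) ℕ.* d                ≡⟨ ℕP.+-assoc c (suc k ℕ.* c) ((2 ℕ.+ k) ℕ.* d) ⟩
  c ℕ.+ (suc k ℕ.* c ℕ.+ (2 ℕ.+ k) ℕ.* d)
    ≡⟨ cong₂ (λ x y → c ℕ.+ (x ℕ.+ y)) ([1+k]*[1+p]C[1+k]≡[1+p]*pCk p k) ([1+k]*[1+p]C[1+k]≡[1+p]*pCk p (suc k)) ⟩
  c ℕ.+ (suc p ℕ.* (p C k) ℕ.+ suc p ℕ.* (p C suc k))  ≡⟨ cong (c ℕ.+_) (ℕP.*-distribˡ-+ (suc p) (p C k) (p C suc k)) ⟨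
  c ℕ.+ suc p ℕ.* (p C k ℕ.+ p C suc k)                ≡⟨ cong (λ z → c ℕ.+ suc p ℕ.* z) (nCk+nC[k+1]≡[n+1]C[k+1] p k) ⟩
  c ℕ.+ suc p ℕ.* c                                    ∎
  where
  open ≡-Reasoning
  c = suc p C suc k
  d = suc p C (2 ℕ.+ k)

pCk*inv[k]≡inv[p]*[1+p]C[1+k] : ∀ p k → ⟦ p C k ⟧ * inv k ≡ inv p * ⟦ suc p C suc k ⟧
pCk*inv[k]≡inv[p]*[1+p]C[1+k] p k = begin
  ⟦ p C k ⟧ * inv k                                  ≡⟨ ℚP.*-identityˡ _ ⟨
  1ℚ * (⟦ p C k ⟧ * inv k)                           ≡⟨ cong (_* (⟦ p C k ⟧ * inv k)) (inv*⟦suc⟧≡1 p) ⟨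
  (inv p * ⟦ suc p ⟧) * (⟦ p C k ⟧ * inv k)
    ≡⟨ solve 4 (λ a b c d → (a :* b) :* (c :* d) := a :* ((b :* c) :* d)) refl (inv p) ⟦ suc p ⟧ ⟦ p C k ⟧ (inv k) ⟩
  inv p * ((⟦ suc p ⟧ * ⟦ p C k ⟧) * inv k)          ≡⟨ cong (λ z → inv p * (z * inv k)) absorb ⟩
  inv p * ((⟦ suc k ⟧ * ⟦ suc p C suc k ⟧) * inv k)
    ≡⟨ solve 4 (λ a b c d → a :* ((b :* c) :* d) := a :* (c :* (d :* b))) refl (inv p) ⟦ suc k ⟧ ⟦ suc p C suc k ⟧ (inv k) ⟩
  inv p * (⟦ suc p C suc k ⟧ * (inv k * ⟦ suc k ⟧))  ≡⟨ cong (λ z → inv p * (⟦ suc p C suc k ⟧ * z)) (inv*⟦suc⟧≡1 k) ⟩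
  inv p * (⟦ suc p C suc k ⟧ * 1ℚ)                   ≡⟨ cong (inv p *_) (ℚP.*-identityʳ _) ⟩
  inv p * ⟦ suc p C suc k ⟧                          ∎
  where
  open ≡-Reasoning
  absorb : ⟦ suc p ⟧ * ⟦ p C k ⟧ ≡ ⟦ suc k ⟧ * ⟦ suc p C suc k ⟧
  absorb = begin
    ⟦ suc p ⟧ * ⟦ p C k ⟧              ≡⟨ ⟦⟧-homo-* (suc p) (p C k) ⟨
    ⟦ suc p ℕ.* (p C k) ⟧              ≡⟨ cong ⟦_⟧ ([1+k]*[1+p]C[1+k]≡[1+p]*pCk p k) ⟨
    ⟦ suc k ℕ.* (suc p C suc k) ⟧      ≡⟨ ⟦⟧-homo-* (suc k) (suc p C suc k) ⟩
    ⟦ suc k ⟧ * ⟦ suc p C suc k ⟧      ∎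

pascal-Σ< : ∀ m (g : ℕ → ℚ) →
            Σ< (2 ℕ.+ m) (λ k → ⟦ suc m C k ⟧ * g k)
            ≡ Σ< (suc m) (λ k → ⟦ m C k ⟧ * g (suc k)) + Σ< (suc m) (λ k → ⟦ m C k ⟧ * g k)
pascal-Σ< m g = begin
  Σ< (2 ℕ.+ m) (λ k → ⟦ suc m C k ⟧ * g k)
    ≡⟨ Σ<-suc-first (suc m) _ ⟩
  ⟦ 1 ⟧ * g 0 + Σ< (suc m) (λ k → ⟦ suc m C suc k ⟧ * g (suc k))
    ≡⟨ cong (⟦ 1 ⟧ * g 0 +_) (trans (Σ<-cong (suc m) split) (Σ<-+ (suc m) _ _)) ⟩
  ⟦ 1 ⟧ * g 0 + (P + Q)
    ≡⟨ solve 3 (λ a x y → a :+ (x :+ y) := x :+ (a :+ y)) refl (⟦ 1 ⟧ * g 0) P Q ⟩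
  P + (⟦ 1 ⟧ * g 0 + Q)
    ≡⟨ cong (P +_) unshifted ⟨
  P + Σ< (suc m) (λ k → ⟦ m C k ⟧ * g k)                        ∎
  where
  open ≡-Reasoning
  P = Σ< (suc m) (λ k → ⟦ m C k ⟧ * g (suc k))
  Q = Σ< (suc m) (λ k → ⟦ m C suc k ⟧ * g (suc k))
  split : ∀ k → ⟦ suc m C suc k ⟧ * g (suc k) ≡ ⟦ m C k ⟧ * g (suc k) + ⟦ m C suc k ⟧ * g (suc k)
  split k = begin
    ⟦ suc m C suc k ⟧ * g (suc k)                      ≡⟨ cong (λ n → ⟦ n ⟧ * g (suc k)) (nCk+nC[k+1]≡[n+1]C[k+1] m k) ⟨
    ⟦ m C k ℕ.+ m C suc k ⟧ * g (suc k)                ≡⟨ cong (_* g (suc k)) (⟦⟧-homo-+ (m C k) (m C suc k)) ⟩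
    (⟦ m C k ⟧ + ⟦ m C suc k ⟧) * g (suc k)            ≡⟨ ℚP.*-distribʳ-+ (g (suc k)) ⟦ m C k ⟧ ⟦ m C suc k ⟧ ⟩
    ⟦ m C k ⟧ * g (suc k) + ⟦ m C suc k ⟧ * g (suc k)  ∎
  unshifted : Σ< (suc m) (λ k → ⟦ m C k ⟧ * g k) ≡ ⟦ 1 ⟧ * g 0 + Q
  unshifted = begin
    Σ< (suc m) (λ k → ⟦ m C k ⟧ * g k)                           ≡⟨ Σ<-suc-first m _ ⟩
    ⟦ 1 ⟧ * g 0 + Σ< m (λ k → ⟦ m C suc k ⟧ * g (suc k))         ≡⟨ cong (⟦ 1 ⟧ * g 0 +_) (ℚP.+-identityʳ _) ⟨
    ⟦ 1 ⟧ * g 0 + (Σ< m (λ k → ⟦ m C suc k ⟧ * g (suc k)) + 0ℚ)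
      ≡⟨ cong (λ z → ⟦ 1 ⟧ * g 0 + (Σ< m (λ k → ⟦ m C suc k ⟧ * g (suc k)) + z)) top ⟨
    ⟦ 1 ⟧ * g 0 + Q                                               ∎
    where
    top : ⟦ m C suc m ⟧ * g (suc m) ≡ 0ℚ
    top = trans (cong (λ n → ⟦ n ⟧ * g (suc m)) (k>n⇒nCk≡0 (ℕP.n<1+n m))) (ℚP.*-zeroˡ (g (suc m)))

⊛-Σ< : ∀ g m (f : ℕ → PS) n → (g ⊛ (λ k → Σ< m (λ j → f j k))) n ≡ Σ< m (λ j → (g ⊛ f j) n)
⊛-Σ< g zero    f n = trans (⊛-comm n g (λ _ → 0ℚ)) (⊛-zeroˡ g n)
⊛-Σ< g (suc m) f n = begin
  (g ⊛ (s ⊕ f m)) n              ≡⟨ ⊛-comm n g (s ⊕ f m) ⟩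
  ((s ⊕ f m) ⊛ g) n              ≡⟨ ⊛-distribʳ s (f m) g n ⟩
  (s ⊛ g) n + (f m ⊛ g) n        ≡⟨ cong₂ _+_ (trans (⊛-comm n s g) (⊛-Σ< g m f n)) (⊛-comm n (f m) g) ⟩
  Σ< m (λ j → (g ⊛ f j) n) + (g ⊛ f m) n ∎
  where
  open ≡-Reasoning
  s : PS
  s k = Σ< m (λ j → f j k)

binomialSum : ℕ → (ℕ → ℚ) → PS
binomialSum m a n = Σ< (suc m) (λ k → ⟦ m C k ⟧ * a k * (expm1 ^ (m ∸ k)) n)

binomialSum-suc : ∀ m a → binomialSum (suc m) a ≈ ((expm1 ⊛ binomialSum m a) ⊕ binomialSum m (λ k → a (suc k)))
binomialSum-suc m a n = begin
  binomialSum (suc m) a n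
    ≡⟨ Σ<-cong (2 ℕ.+ m) (λ k → ℚP.*-assoc ⟦ suc m C k ⟧ (a k) (e (suc m ∸ k))) ⟩
  Σ< (2 ℕ.+ m) (λ k → ⟦ suc m C k ⟧ * g k)
    ≡⟨ pascal-Σ< m g ⟩
  Σ< (suc m) (λ k → ⟦ m C k ⟧ * g (suc k)) + Σ< (suc m) (λ k → ⟦ m C k ⟧ * g k)
    ≡⟨ cong₂ _+_ (Σ<-cong (suc m) (λ k → sym (ℚP.*-assoc ⟦ m C k ⟧ (a (suc k)) (e (m ∸ k))))) lowered ⟩
  binomialSum m (λ k → a (suc k)) n + (expm1 ⊛ binomialSum m a) n
    ≡⟨ ℚP.+-comm (binomialSum m (λ k → a (suc k)) n) ((expm1 ⊛ binomialSum m a) n) ⟩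
  (expm1 ⊛ binomialSum m a) n + binomialSum m (λ k → a (suc k)) n ∎
  where
  open ≡-Reasoning
  e : ℕ → ℚ
  e j = (expm1 ^ j) n
  g : ℕ → ℚ
  g k = a k * e (suc m ∸ k)
  term : ℕ → PS
  term k = (⟦ m C k ⟧ * a k) · (expm1 ^ (m ∸ k))
  lowered : Σ< (suc m) (λ k → ⟦ m C k ⟧ * g k) ≡ (expm1 ⊛ binomialSum m a) n
  lowered = begin
    Σ< (suc m) (λ k → ⟦ m C k ⟧ * g k)
      ≡⟨ Σ<-cong-< (suc m) (λ k k<1+m → cong (λ j → ⟦ m C k ⟧ * (a k * e j)) (ℕP.+-∸-assoc 1 (ℕ.s≤s⁻¹ k<1+m))) ⟩
    Σ< (suc m) (λ k → ⟦ m C k ⟧ * (a k * (expm1 ⊛ (expm1 ^ (m ∸ k))) n))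
      ≡⟨ Σ<-cong (suc m) (λ k → trans (sym (ℚP.*-assoc ⟦ m C k ⟧ (a k) _)) (sym (⊛-·ʳ expm1 (⟦ m C k ⟧ * a k) (expm1 ^ (m ∸ k)) n))) ⟩
    Σ< (suc m) (λ k → (expm1 ⊛ term k) n)
      ≡⟨ ⊛-Σ< expm1 (suc m) term n ⟨
    (expm1 ⊛ binomialSum m a) n ∎

binomialSum-+ : ∀ m a b → binomialSum m (λ k → a k + b k) ≈ (binomialSum m a ⊕ binomialSum m b)
binomialSum-+ m a b n = trans (Σ<-cong (suc m) distrib) (Σ<-+ (suc m) _ _)
  where
  distrib : ∀ k → ⟦ m C k ⟧ * (a k + b k) * (expm1 ^ (m ∸ k)) n
                ≡ ⟦ m C k ⟧ * a k * (expm1 ^ (m ∸ k)) n + ⟦ m C k ⟧ * b k * (expm1 ^ (m ∸ k)) n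
  distrib k = solve 4 (λ c x y z → c :* (x :+ y) :* z := c :* x :* z :+ c :* y :* z) refl ⟦ m C k ⟧ (a k) (b k) ((expm1 ^ (m ∸ k)) n)

eᵗ^≈binomialSum : ∀ m → (eᵗ ^ m) ≈ binomialSum m (λ _ → 1ℚ)
eᵗ^≈binomialSum zero    zero    = refl
eᵗ^≈binomialSum zero    (suc n) = refl
eᵗ^≈binomialSum (suc m) = begin
  (eᵗ ⊛ (eᵗ ^ m))                          ≈⟨ ⊛-congˡ eᵗ (eᵗ^≈binomialSum m) ⟩
  (eᵗ ⊛ b)                                 ≈⟨ ring 2 (λ x y → (x :+ₛ conₛ 1ℚ) :*ₛ y :=ₛ x :*ₛ y :+ₛ y) ≈-refl expm1 b ⟩
  ((expm1 ⊛ b) ⊕ b)                        ≈⟨ binomialSum-suc m (λ _ → 1ℚ) ⟨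
  binomialSum (suc m) (λ _ → 1ℚ)           ∎
  where
  open ≈-Reasoning
  b = binomialSum m (λ _ → 1ℚ)

binomialSum-inv : ∀ p → binomialSum p inv ≈ (const (inv p) ⊛ ((eᵗ ^ suc p) ⊕ (⊖ (expm1 ^ suc p))))
binomialSum-inv p n = begin
  binomialSum p inv n
    ≡⟨ Σ<-cong (suc p) absorb ⟩
  Σ< (suc p) (λ k → inv p * (⟦ suc p C suc k ⟧ * 1ℚ * e (p ∸ k)))
    ≡⟨ Σ<-*ˡ (suc p) (inv p) _ ⟩
  inv p * Σ< (suc p) (λ k → ⟦ suc p C suc k ⟧ * 1ℚ * e (p ∸ k))
    ≡⟨ cong (inv p *_) withoutTop ⟩
  inv p * ((eᵗ ^ suc p) n - e (suc p))
    ≡⟨ ⊛-const (inv p) ((eᵗ ^ suc p) ⊕ (⊖ (expm1 ^ suc p))) n ⟨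
  (const (inv p) ⊛ ((eᵗ ^ suc p) ⊕ (⊖ (expm1 ^ suc p)))) n ∎
  where
  open ≡-Reasoning
  e : ℕ → ℚ
  e j = (expm1 ^ j) n
  absorb : ∀ k → ⟦ p C k ⟧ * inv k * e (p ∸ k) ≡ inv p * (⟦ suc p C suc k ⟧ * 1ℚ * e (p ∸ k))
  absorb k = trans (cong (_* e (p ∸ k)) (pCk*inv[k]≡inv[p]*[1+p]C[1+k] p k))
    (solve 3 (λ i c x → i :* c :* x := i :* (c :* con 1ℚ :* x)) refl (inv p) ⟦ suc p C suc k ⟧ (e (p ∸ k)))
  withoutTop : Σ< (suc p) (λ k → ⟦ suc p C suc k ⟧ * 1ℚ * e (p ∸ k)) ≡ (eᵗ ^ suc p) n - e (suc p)
  withoutTop = begin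
    s                                   ≡⟨ solve 2 (λ s x → s := (con 1ℚ :* con 1ℚ :* x :+ s) :- x) refl s (e (suc p)) ⟩
    (1ℚ * 1ℚ * e (suc p) + s) - e (suc p)  ≡⟨ cong (_- e (suc p)) (trans (eᵗ^≈binomialSum (suc p) n) (Σ<-suc-first (suc p) _)) ⟨
    (eᵗ ^ suc p) n - e (suc p)          ∎
    where
    s = Σ< (suc p) (λ k → ⟦ suc p C suc k ⟧ * 1ℚ * e (p ∸ k))

-- Harmonic sums

harmonicSum : ℕ → PS
harmonicSum p n = Σ< p (λ i → binom p (suc i) * H (suc i) * (expm1 ^ (p ∸ suc i)) n)

harmonicSum≈binomialSum : ∀ p → harmonicSum p ≈ binomialSum p H
harmonicSum≈binomialSum p n = sym (begin
  binomialSum p H n                        ≡⟨ Σ<-suc-first p _ ⟩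
  ⟦ 1 ⟧ * 0ℚ * (expm1 ^ p) n + harmonicSum p n
    ≡⟨ cong (_+ harmonicSum p n) (trans (cong (_* (expm1 ^ p) n) (ℚP.*-zeroʳ ⟦ 1 ⟧)) (ℚP.*-zeroˡ ((expm1 ^ p) n))) ⟩
  0ℚ + harmonicSum p n                     ≡⟨ ℚP.+-identityˡ (harmonicSum p n) ⟩
  harmonicSum p n                          ∎)
  where open ≡-Reasoning

T : ℕ → PS
T zero    = 0ₛ
T (suc p) = (eᵗ ⊛ T p) ⊕ (const (inv p) ⊛ (expm1 ^ suc p))

binomialSum-H : ∀ p → binomialSum p H ≈ ((const (H p) ⊛ (eᵗ ^ p)) ⊕ (⊖ T p))
binomialSum-H zero = ≈-trans (λ { zero → refl ; (suc n) → refl })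
  (ring 1 (λ y → conₛ 0ℚ :=ₛ conₛ 0ℚ :*ₛ y :+ₛ :-ₛ conₛ 0ℚ) ≈-refl 1ₛ)
binomialSum-H (suc p) = begin
  binomialSum (suc p) H
    ≈⟨ binomialSum-suc p H ⟩
  ((expm1 ⊛ s) ⊕ binomialSum p (λ k → H k + inv k))
    ≈⟨ ⊕-congˡ (expm1 ⊛ s) (≈-trans (binomialSum-+ p H inv) (⊕-congˡ s (binomialSum-inv p))) ⟩
  ((expm1 ⊛ s) ⊕ (s ⊕ (i ⊛ ((eᵗ ^ suc p) ⊕ (⊖ (expm1 ^ suc p))))))
    ≈⟨ ⊕-cong (⊛-congˡ expm1 ih) (⊕-congʳ (i ⊛ ((eᵗ ^ suc p) ⊕ (⊖ (expm1 ^ suc p)))) ih) ⟩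
  ((expm1 ⊛ ((h ⊛ y) ⊕ (⊖ T p))) ⊕ (((h ⊛ y) ⊕ (⊖ T p)) ⊕ (i ⊛ (((expm1 ⊕ 1ₛ) ⊛ y) ⊕ (⊖ (expm1 ⊛ E))))))
    ≈⟨ ring 6 (λ x h y t i E → x :*ₛ (h :*ₛ y :-ₛ t) :+ₛ ((h :*ₛ y :-ₛ t) :+ₛ i :*ₛ ((x :+ₛ conₛ 1ℚ) :*ₛ y :-ₛ x :*ₛ E))
                  :=ₛ (h :+ₛ i) :*ₛ ((x :+ₛ conₛ 1ℚ) :*ₛ y) :-ₛ ((x :+ₛ conₛ 1ℚ) :*ₛ t :+ₛ i :*ₛ (x :*ₛ E)))
         ≈-refl expm1 h y (T p) i E ⟩
  (((h ⊕ i) ⊛ (eᵗ ^ suc p)) ⊕ (⊖ T (suc p)))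
    ≈⟨ ⊕-congʳ (⊖ T (suc p)) (⊛-congʳ (eᵗ ^ suc p) (const-+ (H p) (inv p))) ⟨
  ((const (H (suc p)) ⊛ (eᵗ ^ suc p)) ⊕ (⊖ T (suc p))) ∎
  where
  open ≈-Reasoning
  s = binomialSum p H
  h = const (H p)
  i = const (inv p)
  y = eᵗ ^ p
  E = expm1 ^ p
  ih = binomialSum-H p

D-T : ∀ p → D (T p) ≈ (((⟦ p ⟧ₛ ⊛ T p) ⊕ (eᵗ ^ p)) ⊕ (⊖ (expm1 ^ p)))
D-T zero    = ≈-trans (D-const 0ℚ) (ring 1 (λ y → conₛ 0ℚ :=ₛ ((conₛ 0ℚ :*ₛ conₛ 0ℚ) :+ₛ y) :-ₛ y) ≈-refl 1ₛ)
D-T (suc p) = begin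
  D (T (suc p))
    ≈⟨ D-⊕ (eᵗ ⊛ T p) (i ⊛ E₁) ⟩
  (D (eᵗ ⊛ T p) ⊕ D (i ⊛ E₁))
    ≈⟨ ⊕-cong (≈-trans (D-⊛ eᵗ (T p)) (⊕-cong (⊛-congʳ (T p) D-eᵗ) (⊛-congˡ eᵗ (D-T p))))
              (≈-trans (D-const⊛ (inv p) E₁) (inv·D-expm1^ p)) ⟩
  (((eᵗ ⊛ T p) ⊕ (eᵗ ⊛ (((c ⊛ T p) ⊕ y) ⊕ (⊖ E)))) ⊕ (E ⊛ eᵗ))
    ≈⟨ ring 6 (λ v t c y E E₁ → (v :*ₛ t :+ₛ v :*ₛ ((c :*ₛ t :+ₛ y) :-ₛ E)) :+ₛ E :*ₛ v
                  :=ₛ ((((c :+ₛ conₛ 1ℚ) :*ₛ (v :*ₛ t)) :+ₛ E₁) :+ₛ v :*ₛ y) :-ₛ E₁)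
         ≈-refl eᵗ (T p) c y E E₁ ⟩
  ((((( c ⊕ 1ₛ) ⊛ (eᵗ ⊛ T p)) ⊕ E₁) ⊕ (eᵗ ^ suc p)) ⊕ (⊖ E₁))
    ≈⟨ ⊕-congʳ (⊖ E₁) (⊕-congʳ (eᵗ ^ suc p) (⊕-cong (⊛-congʳ (eᵗ ⊛ T p) (⟦suc⟧ₛ p)) (inv-cancel p E₁))) ⟨
  ((((c′ ⊛ (eᵗ ⊛ T p)) ⊕ (i ⊛ (c′ ⊛ E₁))) ⊕ (eᵗ ^ suc p)) ⊕ (⊖ E₁))
    ≈⟨ ring 6 (λ c′ v t i E₁ w → ((c′ :*ₛ (v :*ₛ t) :+ₛ i :*ₛ (c′ :*ₛ E₁)) :+ₛ w) :-ₛ E₁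
                  :=ₛ (c′ :*ₛ (v :*ₛ t :+ₛ i :*ₛ E₁) :+ₛ w) :-ₛ E₁)
         ≈-refl c′ eᵗ (T p) i E₁ (eᵗ ^ suc p) ⟩
  (((c′ ⊛ T (suc p)) ⊕ (eᵗ ^ suc p)) ⊕ (⊖ E₁)) ∎
  where
  open ≈-Reasoning
  c = ⟦ p ⟧ₛ
  c′ = ⟦ suc p ⟧ₛ
  i = const (inv p)
  y = eᵗ ^ p
  E = expm1 ^ p
  E₁ = expm1 ^ suc p

-- The p-Bernoulli generating functions

U : ℕ → PS
U p = (X ⊛ (eᵗ ^ p)) ⊕ (⊖ T p)

rhsReduced : ℕ → PS
rhsReduced p = ⟦ suc p ⟧ₛ ⊛ U p

rhsCleared≈rhsReduced : ∀ p → rhsCleared p ≈ rhsReduced p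
rhsCleared≈rhsReduced p = begin
  rhsCleared p
    ≈⟨ ⊕-cong (·≈const⊛ ⟦ suc p ⟧ ((X ⊕ const (- H p)) ⊛ expS p)) (·≈const⊛ ⟦ suc p ⟧ (harmonicSum p)) ⟩
  ((c′ ⊛ ((X ⊕ const (- H p)) ⊛ expS p)) ⊕ (c′ ⊛ harmonicSum p))
    ≈⟨ ⊕-cong (⊛-congˡ c′ (⊛-cong (⊕-congˡ X (const-neg (H p))) (expS≈eᵗ^ p)))
              (⊛-congˡ c′ (≈-trans (harmonicSum≈binomialSum p) (binomialSum-H p))) ⟩
  ((c′ ⊛ ((X ⊕ (⊖ h)) ⊛ y)) ⊕ (c′ ⊛ ((h ⊛ y) ⊕ (⊖ T p))))
    ≈⟨ ring 5 (λ c′ x h y t → c′ :*ₛ ((x :-ₛ h) :*ₛ y) :+ₛ c′ :*ₛ (h :*ₛ y :-ₛ t) :=ₛ c′ :*ₛ (x :*ₛ y :-ₛ t))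
         ≈-refl c′ X h y (T p) ⟩
  rhsReduced p ∎
  where
  open ≈-Reasoning
  c′ = ⟦ suc p ⟧ₛ
  h = const (H p)
  y = eᵗ ^ p

D-U : ∀ p → D (U p) ≈ ((⟦ p ⟧ₛ ⊛ U p) ⊕ (expm1 ^ p))
D-U p = begin
  D ((X ⊛ y) ⊕ (⊖ T p))
    ≈⟨ ≈-trans (D-⊕ (X ⊛ y) (⊖ T p)) (⊕-cong (D-⊛ X y) (D-⊖ (T p))) ⟩
  (((D X ⊛ y) ⊕ (X ⊛ D y)) ⊕ (⊖ D (T p)))
    ≈⟨ ⊕-cong (⊕-cong (⊛-congʳ y D-X) (⊛-congˡ X (D-eᵗ^ p))) (⊖-cong (D-T p)) ⟩
  (((1ₛ ⊛ y) ⊕ (X ⊛ (c ⊛ y))) ⊕ (⊖ (((c ⊛ T p) ⊕ y) ⊕ (⊖ E))))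
    ≈⟨ ring 5 (λ c x y t E → (conₛ 1ℚ :*ₛ y :+ₛ x :*ₛ (c :*ₛ y)) :-ₛ ((c :*ₛ t :+ₛ y) :-ₛ E)
                  :=ₛ c :*ₛ (x :*ₛ y :-ₛ t) :+ₛ E)
         ≈-refl c X y (T p) E ⟩
  ((c ⊛ U p) ⊕ E) ∎
  where
  open ≈-Reasoning
  c = ⟦ p ⟧ₛ
  y = eᵗ ^ p
  E = expm1 ^ p

-- By the power rule, L p ((eᵗ - 1)^(p+1) f) = (eᵗ - 1)^(p+2) (p f - f′), which the recurrence
-- turns into coeff p · (eᵗ - 1)^(p+2) F_(p+1) when f = F_p.
L : ℕ → PS → PS
L p Z = (((⟦ p ⟧ₛ ⊛ expm1) ⊛ Z) ⊕ (⊖ (expm1 ⊛ D Z))) ⊕ (⟦ suc p ⟧ₛ ⊛ (eᵗ ⊛ Z))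

L-cong : ∀ p {Z Z′} → Z ≈ Z′ → L p Z ≈ L p Z′
L-cong p Z≈Z′ = ⊕-cong (⊕-cong (⊛-congˡ (⟦ p ⟧ₛ ⊛ expm1) Z≈Z′) (⊖-cong (⊛-congˡ expm1 (D-cong Z≈Z′))))
                       (⊛-congˡ ⟦ suc p ⟧ₛ (⊛-congˡ eᵗ Z≈Z′))

L-rhsReduced : ∀ p → L p (rhsReduced p) ≈ ((⟦ suc p ⟧ₛ ⊛ ⟦ suc p ⟧ₛ) ⊛ U (suc p))
L-rhsReduced p = begin
  L p (c′ ⊛ U p)
    ≈⟨ ⊕-congʳ (c′ ⊛ (eᵗ ⊛ (c′ ⊛ U p))) (⊕-congˡ ((c ⊛ expm1) ⊛ (c′ ⊛ U p))
         (⊖-cong (⊛-congˡ expm1 (≈-trans (D-const⊛ ⟦ suc p ⟧ (U p)) (⊛-congˡ c′ (D-U p)))))) ⟩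
  ((((c ⊛ expm1) ⊛ (c′ ⊛ U p)) ⊕ (⊖ (expm1 ⊛ (c′ ⊛ ((c ⊛ U p) ⊕ E))))) ⊕ (c′ ⊛ (eᵗ ⊛ (c′ ⊛ U p))))
    ≈⟨ ring 6 (λ c c′ x u E v → ((c :*ₛ x) :*ₛ (c′ :*ₛ u) :-ₛ x :*ₛ (c′ :*ₛ (c :*ₛ u :+ₛ E))) :+ₛ c′ :*ₛ (v :*ₛ (c′ :*ₛ u))
                  :=ₛ (c′ :*ₛ c′) :*ₛ (v :*ₛ u) :-ₛ c′ :*ₛ (x :*ₛ E))
         ≈-refl c c′ expm1 (U p) E eᵗ ⟩
  (((c′ ⊛ c′) ⊛ (eᵗ ⊛ U p)) ⊕ (⊖ (c′ ⊛ (expm1 ⊛ E))))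
    ≈⟨ ⊕-congˡ ((c′ ⊛ c′) ⊛ (eᵗ ⊛ U p)) (⊖-cong (⊛-congˡ c′ (inv-cancel p (expm1 ⊛ E)))) ⟨
  (((c′ ⊛ c′) ⊛ (eᵗ ⊛ U p)) ⊕ (⊖ (c′ ⊛ (i ⊛ (c′ ⊛ (expm1 ⊛ E))))))
    ≈⟨ ring 7 (λ c′ v x y t i E → (c′ :*ₛ c′) :*ₛ (v :*ₛ (x :*ₛ y :-ₛ t)) :-ₛ c′ :*ₛ (i :*ₛ (c′ :*ₛ E))
                  :=ₛ (c′ :*ₛ c′) :*ₛ (x :*ₛ (v :*ₛ y) :-ₛ (v :*ₛ t :+ₛ i :*ₛ E)))
         ≈-refl c′ eᵗ X (eᵗ ^ p) (T p) i (expm1 ⊛ E) ⟩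
  ((c′ ⊛ c′) ⊛ U (suc p)) ∎
  where
  open ≈-Reasoning
  c = ⟦ p ⟧ₛ
  c′ = ⟦ suc p ⟧ₛ
  i = const (inv p)
  E = expm1 ^ p

coeff⊛rhsReduced-suc : ∀ p → (const (coeff p) ⊛ rhsReduced (suc p)) ≈ ((⟦ suc p ⟧ₛ ⊛ ⟦ suc p ⟧ₛ) ⊛ U (suc p))
coeff⊛rhsReduced-suc p = begin
  (κ ⊛ (⟦ 2 ℕ.+ p ⟧ₛ ⊛ U (suc p)))        ≈⟨ ring 3 (λ κ c u → κ :*ₛ (c :*ₛ u) :=ₛ (κ :*ₛ c) :*ₛ u) ≈-refl κ ⟦ 2 ℕ.+ p ⟧ₛ (U (suc p)) ⟩
  ((κ ⊛ ⟦ 2 ℕ.+ p ⟧ₛ) ⊛ U (suc p))        ≈⟨ ⊛-congʳ (U (suc p)) (const-⊛ (coeff p) ⟦ 2 ℕ.+ p ⟧) ⟩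
  (const (coeff p * ⟦ 2 ℕ.+ p ⟧) ⊛ U (suc p))
    ≈⟨ ⊛-congʳ (U (suc p)) (λ n → cong (λ a → const a n) (coeff*⟦2+p⟧ p)) ⟩
  (const (⟦ suc p ⟧ * ⟦ suc p ⟧) ⊛ U (suc p)) ≈⟨ ⊛-congʳ (U (suc p)) (const-⊛ ⟦ suc p ⟧ ⟦ suc p ⟧) ⟨
  ((⟦ suc p ⟧ₛ ⊛ ⟦ suc p ⟧ₛ) ⊛ U (suc p)) ∎
  where
  open ≈-Reasoning
  κ = const (coeff p)

coeff⊛-cancel : ∀ p {f g} → (const (coeff p) ⊛ f) ≈ (const (coeff p) ⊛ g) → f ≈ g
coeff⊛-cancel p {f} {g} eq n =
  *-cancelˡ-coeff p (trans (sym (⊛-const (coeff p) f n)) (trans (eq n) (⊛-const (coeff p) g n)))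

module _ (B : ℕ → ℕ → ℚ) (classical : IsClassicalBernoulli (λ n → B n 0)) (rec : PBernoulliRec B) where

  F : ℕ → PS
  F p = egf (λ n → B n p)

  coeff⊛F-suc : ∀ p → (const (coeff p) ⊛ F (suc p)) ≈ ((⟦ p ⟧ₛ ⊛ F p) ⊕ (⊖ D (F p)))
  coeff⊛F-suc p n = begin
    (const (coeff p) ⊛ F (suc p)) n
      ≡⟨ ⊛-const (coeff p) (F (suc p)) n ⟩
    coeff p * (B n (suc p) * invFact n)
      ≡⟨ solve 5 (λ κ P b b′ f → κ :* (b′ :* f) := P :* (b :* f) :+ :- ((P :* b :- κ :* b′) :* f))
           refl (coeff p) ⟦ p ⟧ (B n p) (B n (suc p)) (invFact n) ⟩
    ⟦ p ⟧ * F p n + - ((⟦ p ⟧ * B n p - coeff p * B n (suc p)) * invFact n)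
      ≡⟨ cong₂ (λ x y → x + - (y * invFact n)) (⊛-const ⟦ p ⟧ (F p) n) (rec n p) ⟨
    (⟦ p ⟧ₛ ⊛ F p) n + - (B (suc n) p * invFact n)
      ≡⟨ cong (λ z → (⟦ p ⟧ₛ ⊛ F p) n + - (B (suc n) p * z)) (invFact-suc n) ⟨
    (⟦ p ⟧ₛ ⊛ F p) n + - (B (suc n) p * (⟦ suc n ⟧ * invFact (suc n)))
      ≡⟨ cong (λ z → (⟦ p ⟧ₛ ⊛ F p) n + - z)
           (solve 3 (λ b c f → b :* (c :* f) := c :* (b :* f)) refl (B (suc n) p) ⟦ suc n ⟧ (invFact (suc n))) ⟩
    (⟦ p ⟧ₛ ⊛ F p) n + - D (F p) n ∎
    where open ≡-Reasoning

  lhsCleared : ℕ → PS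
  lhsCleared p = (expm1 ^ suc p) ⊛ F p

  D-lhsCleared : ∀ p → D (lhsCleared p) ≈ (((⟦ suc p ⟧ₛ ⊛ ((expm1 ^ p) ⊛ eᵗ)) ⊛ F p) ⊕ ((expm1 ^ suc p) ⊛ D (F p)))
  D-lhsCleared p = ≈-trans (D-⊛ (expm1 ^ suc p) (F p)) (⊕-congʳ ((expm1 ^ suc p) ⊛ D (F p)) (⊛-congʳ (F p)
    (≈-trans (D-^ expm1 p) (⊛-congˡ ⟦ suc p ⟧ₛ (⊛-congˡ (expm1 ^ p) D-expm1)))))

  coeff⊛lhsCleared-suc : ∀ p → (const (coeff p) ⊛ lhsCleared (suc p)) ≈ L p (lhsCleared p)
  coeff⊛lhsCleared-suc p = begin
    (κ ⊛ ((expm1 ⊛ E₁) ⊛ F (suc p)))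
      ≈⟨ ring 4 (λ κ x E₁ f → κ :*ₛ ((x :*ₛ E₁) :*ₛ f) :=ₛ (x :*ₛ E₁) :*ₛ (κ :*ₛ f)) ≈-refl κ expm1 E₁ (F (suc p)) ⟩
    ((expm1 ⊛ E₁) ⊛ (κ ⊛ F (suc p)))
      ≈⟨ ⊛-congˡ (expm1 ⊛ E₁) (coeff⊛F-suc p) ⟩
    ((expm1 ⊛ E₁) ⊛ ((c ⊛ F p) ⊕ (⊖ D (F p))))
      ≈⟨ ring 7 (λ c c′ x E v f f′ → (x :*ₛ (x :*ₛ E)) :*ₛ (c :*ₛ f :-ₛ f′)
                    :=ₛ ((c :*ₛ x) :*ₛ ((x :*ₛ E) :*ₛ f) :-ₛ x :*ₛ ((c′ :*ₛ (E :*ₛ v)) :*ₛ f :+ₛ (x :*ₛ E) :*ₛ f′))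
                        :+ₛ c′ :*ₛ (v :*ₛ ((x :*ₛ E) :*ₛ f)))
           ≈-refl c c′ expm1 (expm1 ^ p) eᵗ (F p) (D (F p)) ⟩
    ((((c ⊛ expm1) ⊛ G) ⊕ (⊖ (expm1 ⊛ (((c′ ⊛ ((expm1 ^ p) ⊛ eᵗ)) ⊛ F p) ⊕ (E₁ ⊛ D (F p)))))) ⊕ (c′ ⊛ (eᵗ ⊛ G)))
      ≈⟨ ⊕-congʳ (c′ ⊛ (eᵗ ⊛ G)) (⊕-congˡ ((c ⊛ expm1) ⊛ G) (⊖-cong (⊛-congˡ expm1 (D-lhsCleared p)))) ⟨
    L p G ∎
    where
    open ≈-Reasoning
    κ = const (coeff p)
    c = ⟦ p ⟧ₛ
    c′ = ⟦ suc p ⟧ₛ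
    E₁ = expm1 ^ suc p
    G = lhsCleared p

  lhsCleared≈rhsReduced : ∀ p → lhsCleared p ≈ rhsReduced p
  lhsCleared≈rhsReduced zero = begin
    ((expm1 ⊛ 1ₛ) ⊛ F 0)  ≈⟨ ring 2 (λ x f → (x :*ₛ conₛ 1ℚ) :*ₛ f :=ₛ f :*ₛ x) ≈-refl expm1 (F 0) ⟩
    (F 0 ⊛ expm1)         ≈⟨ classical ⟩
    X                     ≈⟨ ring 1 (λ x → x :=ₛ conₛ 1ℚ :*ₛ (x :*ₛ conₛ 1ℚ :-ₛ conₛ 0ℚ)) ≈-refl X ⟩
    rhsReduced 0          ∎
    where open ≈-Reasoning
  lhsCleared≈rhsReduced (suc p) = coeff⊛-cancel p (begin
    (const (coeff p) ⊛ lhsCleared (suc p))      ≈⟨ coeff⊛lhsCleared-suc p ⟩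
    L p (lhsCleared p)                          ≈⟨ L-cong p (lhsCleared≈rhsReduced p) ⟩
    L p (rhsReduced p)                          ≈⟨ L-rhsReduced p ⟩
    ((⟦ suc p ⟧ₛ ⊛ ⟦ suc p ⟧ₛ) ⊛ U (suc p))     ≈⟨ coeff⊛rhsReduced-suc p ⟨
    (const (coeff p) ⊛ rhsReduced (suc p))      ∎)
    where open ≈-Reasoning

theorem1 : (B : ℕ → ℕ → ℚ) → IsClassicalBernoulli (λ n → B n 0) → PBernoulliRec B →
    ∀ p n → ((expm1 ^ suc p) ⊛ egf (λ m → B m p)) n ≡ rhsCleared p n
theorem1 B classical rec p n = trans (lhsCleared≈rhsReduced B classical rec p n) (sym (rhsCleared≈rhsReduced p n))
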